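{- Let $n\ge 1$ and $f:\{0,1\}^n\to\{0,1\}$. Then the limit $b_{avg}(f)=\lim_{m\to\infty}\frac{b_m(f)}{m}$ exists, and $$b_{avg}(f)=\inf\left\{\frac{b_m(f)}{m}: m\ge 1\right\}.$$
   Context: A branching program on variables $x_1,\dots,x_n$ is a finite directed acyclic multigraph $G$ with labeled edges and distinguished sets of start nodes, accept nodes and reject nodes such that: every vertex has outdegree $0$ or $2$; for each vertex of outdegree $2$ there is an $i\in[1,n]$ such that one outgoing edge is labeled $x_i=0$ and the other is labeled $x_i=1$; every vertex of outdegree $0$ is an accept node or a reject node. On input $x\in\{0,1\}^n$, starting from a start node $s$, one follows the unique path whose edge labels agree with $x$ until reaching a vertex of outdegree $0$, and accepts or rejects according to whether it is an accept or reject node. The size of $G$ is $|V(G)|$. A branching program computes $f$ $m$ times if it has $m$ start nodes $s_1,\dots,s_m$, $m$ accept nodes $a_1,\dots,a_m$ and $m$ reject nodes $r_1,\dots,r_m$, and for every $i$ and every input $x$, the computation starting at $s_i$ on input $x$ ends at $a_i$ if $f(x)=1$ and at $r_i$ if $f(x)=0$. $b_m(f)$ denotes the minimum size of a branching program computing $f$ $m$ times. -}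

module Defs where

open import Data.Nat using (ℕ; zero; suc; _+_; _*_; _≤_; _<_)
open import Data.Fin using (Fin; toℕ)
open import Data.Bool using (Bool; true; false; if_then_else_)
open import Data.Product using (Σ; _×_; ∃)
open import Relation.Binary.PropositionalEquality using (_≡_)
open import Function.Definitions using (Injective)

-- An input is an assignment x : Fin n → Bool  (x_i = 1 iff x i ≡ true).
Input : ℕ → Set
Input n = Fin n → Bool

-- A vertex of a branching program with N vertices on variables x_1..x_n:
-- either an outdegree-0 vertex labelled accept (true) / reject (false),
-- or an outdegree-2 vertex querying variable i, with the edge
-- "x_i = 0" going to c0 and the edge "x_i = 1" going to c1
-- (c0 ≡ c1 is allowed: multigraph).
data Node (n N : ℕ) : Set where
  leaf   : Bool → Node n N
  branch : Fin n → Fin N → Fin N → Node n N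

-- Acyclicity: every edge goes from a vertex to a vertex of larger index
-- (a topological numbering; every finite DAG admits one, and the size is
-- unaffected by renumbering).
data EdgesForward {n N : ℕ} (v : Fin N) : Node n N → Set where
  leafOK   : ∀ b → EdgesForward v (leaf b)
  branchOK : ∀ i c0 c1 → toℕ v < toℕ c0 → toℕ v < toℕ c1
           → EdgesForward v (branch i c0 c1)

record BP (n N : ℕ) : Set where
  field
    node    : Fin N → Node n N
    acyclic : ∀ v → EdgesForward v (node v)

data Reaches {n N : ℕ} (G : BP n N) (x : Input n) : Fin N → Fin N → Set where
  here : ∀ {v} → Reaches G x v v
  step : ∀ {u v i c0 c1} → BP.node G u ≡ branch i c0 c1
       → Reaches G x (if x i then c1 else c0) v
       → Reaches G x u v

-- G computes f m times: m distinct start nodes, m distinct accept nodes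
-- (outdegree 0, accepting), m distinct reject nodes (outdegree 0,
-- rejecting), and from s_j the computation ends at a_j if f x = 1 and at
-- r_j if f x = 0 (reaching an outdegree-0 vertex means the path ends there).
record ComputesTimes {n N : ℕ} (G : BP n N) (f : Input n → Bool) (m : ℕ) : Set where
  field
    start  : Fin m → Fin N
    accept : Fin m → Fin N
    reject : Fin m → Fin N
    start-inj  : Injective _≡_ _≡_ start
    accept-inj : Injective _≡_ _≡_ accept
    reject-inj : Injective _≡_ _≡_ reject
    accept-leaf : ∀ j → BP.node G (accept j) ≡ leaf true
    reject-leaf : ∀ j → BP.node G (reject j) ≡ leaf false
    correct-1 : ∀ j x → f x ≡ true  → Reaches G x (start j) (accept j)
    correct-0 : ∀ j x → f x ≡ false → Reaches G x (start j) (reject j)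

HasBP : ∀ {n} → (Input n → Bool) → (m N : ℕ) → Set
HasBP {n} f m N = Σ (BP n N) λ G → ComputesTimes G f m

IsBm : ∀ {n} → (Input n → Bool) → (m s : ℕ) → Set
IsBm f m s = HasBP f m s × (∀ N → HasBP f m N → s ≤ N)

-- Copies of a program can be placed side by side: the disjoint union of a program computing
-- f a times and one computing f b times computes f (a + b) times, so b_{a+b} ≤ b_a + b_b, and
-- dropping start/accept/reject triples shows that b_m is monotone in m. Hence for m ≤ c k with
-- c = ⌊m/k⌋ + 1 we get b_m ≤ c b_k ≤ (m + k) b_k / k, i.e. b_m/m ≤ b_k/k + b_k/m, which is
-- below b_k/k + ε once m > b_k/ε (Fekete's argument for subadditive sequences).
module Submission where

open import Defs
open import Data.Nat using (ℕ; suc; _+_; _*_; _≤_; _<_; NonZero; _/_; _%_)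
open import Data.Product using (∃; _,_)
open import Data.Bool using (Bool; true; false)
open import Data.Nat.Properties
open import Data.Nat.DivMod using (m≡m%n+[m/n]*n; m%n<n; m/n*n≤m)
open import Data.Nat.Tactic.RingSolver using (solve-∀)
open import Data.Fin using (Fin; toℕ; _↑ˡ_; _↑ʳ_; splitAt; inject≤)
open import Data.Fin.Properties
  using (toℕ<n; toℕ-↑ˡ; toℕ-↑ʳ; ↑ˡ-injective; ↑ʳ-injective; inject≤-injective; splitAt⁻¹-↑ˡ; splitAt⁻¹-↑ʳ)
open import Data.Vec.Functional using (_++_)
open import Data.Vec.Functional.Properties using (lookup-++ˡ; lookup-++ʳ)
import Data.Vec.Functional.Relation.Unary.All.Properties as All
import Data.Vec.Functional.Relation.Binary.Pointwise.Properties as Pointwise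
open import Data.Sum using (inj₁; inj₂)
open import Data.Bool.Properties using (if-float)
open import Data.Empty using (⊥-elim)
open import Function using (_∘_)
open import Function.Definitions using (Injective)
open import Relation.Binary.PropositionalEquality

module _ {A : Set} {m n : ℕ} {xs : Fin m → A} {ys : Fin n → A} where

  ++-injective : Injective _≡_ _≡_ xs → Injective _≡_ _≡_ ys → (∀ i j → xs i ≢ ys j) →
                 Injective _≡_ _≡_ (xs ++ ys)
  ++-injective xs-inj ys-inj disjoint {i} {j} eq with splitAt m i in ei | splitAt m j in ej
  ... | inj₁ i′ | inj₁ j′ =
    trans (sym (splitAt⁻¹-↑ˡ ei)) (trans (cong (_↑ˡ n) (xs-inj eq)) (splitAt⁻¹-↑ˡ ej))
  ... | inj₁ i′ | inj₂ j′ = ⊥-elim (disjoint i′ j′ eq)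
  ... | inj₂ i′ | inj₁ j′ = ⊥-elim (disjoint j′ i′ (sym eq))
  ... | inj₂ i′ | inj₂ j′ =
    trans (sym (splitAt⁻¹-↑ʳ ei)) (trans (cong (m ↑ʳ_) (ys-inj eq)) (splitAt⁻¹-↑ʳ ej))

↑ˡ-mono-< : ∀ {m} n {u v : Fin m} → toℕ u < toℕ v → toℕ (u ↑ˡ n) < toℕ (v ↑ˡ n)
↑ˡ-mono-< n {u} {v} = subst₂ _<_ (sym (toℕ-↑ˡ u n)) (sym (toℕ-↑ˡ v n))

↑ʳ-mono-< : ∀ {n} m {u v : Fin n} → toℕ u < toℕ v → toℕ (m ↑ʳ u) < toℕ (m ↑ʳ v)
↑ʳ-mono-< m {u} {v} = subst₂ _<_ (sym (toℕ-↑ʳ m u)) (sym (toℕ-↑ʳ m v)) ∘ +-monoʳ-< m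

↑ˡ≢↑ʳ : ∀ {m n} (u : Fin m) (v : Fin n) → u ↑ˡ n ≢ m ↑ʳ v
↑ˡ≢↑ʳ {m} {n} u v eq = <⇒≢ u↑ˡn<m↑ʳv (cong toℕ eq)
  where
  open ≤-Reasoning
  u↑ˡn<m↑ʳv : toℕ (u ↑ˡ n) < toℕ (m ↑ʳ v)
  u↑ˡn<m↑ʳv = begin-strict
    toℕ (u ↑ˡ n) ≡⟨ toℕ-↑ˡ u n ⟩
    toℕ u        <⟨ toℕ<n u ⟩
    m            ≤⟨ m≤m+n m (toℕ v) ⟩
    m + toℕ v    ≡⟨ toℕ-↑ʳ m v ⟨
    toℕ (m ↑ʳ v) ∎

module _ {n : ℕ} where

  mapNode : ∀ {N N′} → (Fin N → Fin N′) → Node n N → Node n N′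
  mapNode φ (leaf b)         = leaf b
  mapNode φ (branch i c₀ c₁) = branch i (φ c₀) (φ c₁)

  mapNode-edgesForward : ∀ {N N′} (φ : Fin N → Fin N′) →
                         (∀ {u v} → toℕ u < toℕ v → toℕ (φ u) < toℕ (φ v)) →
                         ∀ {u nd} → EdgesForward u nd → EdgesForward (φ u) (mapNode φ nd)
  mapNode-edgesForward φ mono (leafOK b) = leafOK b
  mapNode-edgesForward φ mono (branchOK i c₀ c₁ u<c₀ u<c₁) =
    branchOK i (φ c₀) (φ c₁) (mono u<c₀) (mono u<c₁)

  record Embedding {N N′} (G : BP n N) (H : BP n N′) : Set where
    field
      embed           : Fin N → Fin N′
      embed-injective : Injective _≡_ _≡_ embed
      node-embed      : ∀ u → BP.node H (embed u) ≡ mapNode embed (BP.node G u)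

    reaches-embed : ∀ {x u v} → Reaches G x u v → Reaches H x (embed u) (embed v)
    reaches-embed here = here
    reaches-embed {x} (step {i = i} node-u r) =
      step (trans (node-embed _) (cong (mapNode embed) node-u))
           (subst (λ w → Reaches H x w _) (if-float embed (x i)) (reaches-embed r))

    leaf-embed : ∀ {u b} → BP.node G u ≡ leaf b → BP.node H (embed u) ≡ leaf b
    leaf-embed node-u = trans (node-embed _) (cong (mapNode embed) node-u)

  module _ {N N′} (G : BP n N) (H : BP n N′) where

    private
      unionNode : Fin (N + N′) → Node n (N + N′)
      unionNode = (mapNode (_↑ˡ N′) ∘ BP.node G) ++ (mapNode (N ↑ʳ_) ∘ BP.node H)

      unionNode-acyclic : ∀ v → EdgesForward v (unionNode v)
      unionNode-acyclic v with splitAt N v in e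
      ... | inj₁ u = subst (λ w → EdgesForward w _) (splitAt⁻¹-↑ˡ e)
                       (mapNode-edgesForward (_↑ˡ N′) (↑ˡ-mono-< N′) (BP.acyclic G u))
      ... | inj₂ u = subst (λ w → EdgesForward w _) (splitAt⁻¹-↑ʳ e)
                       (mapNode-edgesForward (N ↑ʳ_) (↑ʳ-mono-< N) (BP.acyclic H u))

    _⊕_ : BP n (N + N′)
    _⊕_ = record { node = unionNode ; acyclic = unionNode-acyclic }

    ⊕-inl : Embedding G _⊕_
    ⊕-inl = record
      { embed = _↑ˡ N′
      ; embed-injective = ↑ˡ-injective N′ _ _
      ; node-embed = lookup-++ˡ (mapNode (_↑ˡ N′) ∘ BP.node G) _ }

    ⊕-inr : Embedding H _⊕_
    ⊕-inr = record
      { embed = N ↑ʳ_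
      ; embed-injective = ↑ʳ-injective N _ _
      ; node-embed = lookup-++ʳ (mapNode (_↑ˡ N′) ∘ BP.node G) _ }

module _ {n N : ℕ} {H : BP n N} {f : Input n → Bool} where
  open ComputesTimes
  open Embedding

  computesTimes-reindex : ∀ {m m′} (ρ : Fin m → Fin m′) → Injective _≡_ _≡_ ρ →
                          ComputesTimes H f m′ → ComputesTimes H f m
  computesTimes-reindex ρ ρ-inj C = record
    { start = start C ∘ ρ ; accept = accept C ∘ ρ ; reject = reject C ∘ ρ
    ; start-inj = ρ-inj ∘ start-inj C ; accept-inj = ρ-inj ∘ accept-inj C
    ; reject-inj = ρ-inj ∘ reject-inj C
    ; accept-leaf = accept-leaf C ∘ ρ ; reject-leaf = reject-leaf C ∘ ρ
    ; correct-1 = correct-1 C ∘ ρ ; correct-0 = correct-0 C ∘ ρ }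

  computesTimes-++ : ∀ {N₁ N₂ a b} {G₁ : BP n N₁} {G₂ : BP n N₂}
                     (e₁ : Embedding G₁ H) (e₂ : Embedding G₂ H) → (∀ u v → embed e₁ u ≢ embed e₂ v) →
                     ComputesTimes G₁ f a → ComputesTimes G₂ f b → ComputesTimes H f (a + b)
  computesTimes-++ {N₁} {N₂} {a} {b} e₁ e₂ disjoint C₁ C₂ = record
    { start  = embed-++ (start C₁) (start C₂)
    ; accept = embed-++ (accept C₁) (accept C₂)
    ; reject = embed-++ (reject C₁) (reject C₂)
    ; start-inj  = embed-++-injective (start-inj C₁) (start-inj C₂)
    ; accept-inj = embed-++-injective (accept-inj C₁) (accept-inj C₂)
    ; reject-inj = embed-++-injective (reject-inj C₁) (reject-inj C₂)
    ; accept-leaf = All.++⁺ (λ v → BP.node H v ≡ leaf true)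
                      (leaf-embed e₁ ∘ accept-leaf C₁) (leaf-embed e₂ ∘ accept-leaf C₂)
    ; reject-leaf = All.++⁺ (λ v → BP.node H v ≡ leaf false)
                      (leaf-embed e₁ ∘ reject-leaf C₁) (leaf-embed e₂ ∘ reject-leaf C₂)
    ; correct-1 = λ j x fx → Pointwise.++⁺ (Reaches H x)
        (λ i → reaches-embed e₁ (correct-1 C₁ i x fx)) (λ i → reaches-embed e₂ (correct-1 C₂ i x fx)) j
    ; correct-0 = λ j x fx → Pointwise.++⁺ (Reaches H x)
        (λ i → reaches-embed e₁ (correct-0 C₁ i x fx)) (λ i → reaches-embed e₂ (correct-0 C₂ i x fx)) j }
    where
    embed-++ : (Fin a → Fin N₁) → (Fin b → Fin N₂) → Fin (a + b) → Fin N
    embed-++ s t = (embed e₁ ∘ s) ++ (embed e₂ ∘ t)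

    embed-++-injective : ∀ {s t} → Injective _≡_ _≡_ s → Injective _≡_ _≡_ t → Injective _≡_ _≡_ (embed-++ s t)
    embed-++-injective {s} {t} s-inj t-inj =
      ++-injective (s-inj ∘ embed-injective e₁) (t-inj ∘ embed-injective e₂) (λ i j → disjoint (s i) (t j))

module _ {n : ℕ} {f : Input n → Bool} where

  HasBP-0 : HasBP f 0 0
  HasBP-0 = record { node = λ () ; acyclic = λ () } , record
    { start = λ () ; accept = λ () ; reject = λ ()
    ; start-inj = λ { {()} } ; accept-inj = λ { {()} } ; reject-inj = λ { {()} }
    ; accept-leaf = λ () ; reject-leaf = λ () ; correct-1 = λ () ; correct-0 = λ () }

  HasBP-+ : ∀ {a b N N′} → HasBP f a N → HasBP f b N′ → HasBP f (a + b) (N + N′)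
  HasBP-+ (G , C) (G′ , C′) = G ⊕ G′ , computesTimes-++ (⊕-inl G G′) (⊕-inr G G′) ↑ˡ≢↑ʳ C C′

  HasBP-* : ∀ c {k N} → HasBP f k N → HasBP f (c * k) (c * N)
  HasBP-* 0       _ = HasBP-0
  HasBP-* (suc c) P = HasBP-+ P (HasBP-* c P)

  HasBP-≤ : ∀ {m m′ N} → m ≤ m′ → HasBP f m′ N → HasBP f m N
  HasBP-≤ m≤m′ (G , C) =
    G , computesTimes-reindex (λ j → inject≤ j m≤m′) (inject≤-injective m≤m′ m≤m′ _ _) C

m≤[1+m/n]*n : ∀ m n .{{_ : NonZero n}} → m ≤ suc (m / n) * n
m≤[1+m/n]*n m n = begin
  m                 ≡⟨ m≡m%n+[m/n]*n m n ⟩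
  m % n + m / n * n ≤⟨ +-monoˡ-≤ (m / n * n) (<⇒≤ (m%n<n m n)) ⟩
  n + m / n * n     ∎
  where open ≤-Reasoning

[1+m/n]*n≤n+m : ∀ m n .{{_ : NonZero n}} → suc (m / n) * n ≤ n + m
[1+m/n]*n≤n+m m n = +-monoʳ-≤ n (m/n*n≤m m n)

average-bound : ∀ {bm bk c k m D} .{{_ : NonZero k}} →
                bm ≤ c * bk → c * k ≤ k + m → bk * D < m → bm * k * D < bk * m * D + m * k
average-bound {bm} {bk} {c} {k} {m} {D} bm≤c*bk c*k≤k+m bk*D<m = begin-strict
  bm * k * D                ≤⟨ *-monoˡ-≤ D (*-monoˡ-≤ k bm≤c*bk) ⟩
  c * bk * k * D            ≡⟨ reassociate c bk k D ⟩
  bk * (c * k) * D          ≤⟨ *-monoˡ-≤ D (*-monoʳ-≤ bk c*k≤k+m) ⟩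
  bk * (k + m) * D          ≡⟨ distribute bk k m D ⟩
  bk * D * k + bk * m * D   <⟨ +-monoˡ-< (bk * m * D) (*-monoˡ-< k bk*D<m) ⟩
  m * k + bk * m * D        ≡⟨ +-comm (m * k) _ ⟩
  bk * m * D + m * k        ∎
  where
  open ≤-Reasoning
  reassociate : ∀ c bk k D → c * bk * k * D ≡ bk * (c * k) * D
  reassociate = solve-∀
  distribute : ∀ bk k m D → bk * (k + m) * D ≡ bk * D * k + bk * m * D
  distribute = solve-∀

mainTheorem1 : ∀ (n : ℕ) → 1 ≤ n → (f : Input n → Bool) →
    ∀ (k bk : ℕ) → 1 ≤ k → IsBm f k bk →
    ∀ (d : ℕ) → ∃ λ M → ∀ (m bm : ℕ) → M ≤ m → IsBm f m bm →
    bm * k * suc d < bk * m * suc d + m * k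
mainTheorem1 _ _ f k@(suc _) bk _ (bk-achieved , _) d =
  suc (bk * suc d) , λ m bm bk*D<m (_ , bm-minimal) →
    let c = suc (m / k)
        bm≤c*bk = bm-minimal (c * bk) (HasBP-≤ (m≤[1+m/n]*n m k) (HasBP-* c bk-achieved))
    in average-bound {bk = bk} {c = c} bm≤c*bk ([1+m/n]*n≤n+m m k) bk*D<m
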